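{- Let $b=(B_1,\dots,B_k)$ be a bonsai sequence on $[n]$ of type $(t_1,\dots,t_k)$. The number of rooted trees on $[n]$ whose bonsai sequence is $b$ equals \[ t_1(t_1+t_2)\cdots(t_1+t_2+\cdots+t_{k-1})=[t]_{k-1}!, \] where $[t]_i=t_1+\cdots+t_i$ and $[t]_i!=[t]_1\cdots[t]_i$ (empty product $=1$ when $k=1$).
   Context: A bonsai is a rooted labelled tree whose root has the largest label. A bonsai sequence on $[n]=\{1,\dots,n\}$ is a sequence $(B_1,\dots,B_k)$ of bonsais with pairwise disjoint label sets whose union is $[n]$, ordered by increasing root label, such that the root of each $B_i$ exceeds every label of $B_1,\dots,B_{i-1}$; its type is $(|B_1|,\dots,|B_k|)$. A rooted tree on $[n]$ is a labelled tree on $[n]$ with a distinguished root; a vertex is a record if its label is the largest on the path from it to the root (inclusive). The bonsai sequence of a rooted tree is obtained by deleting every edge joining a non-root record to its parent, which yields bonsais rooted at the records, and ordering them by increasing root label. -}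

module Defs where

open import Data.Nat using (ℕ; zero; suc; _+_; _*_; _≡ᵇ_; _≤ᵇ_; _<ᵇ_)
open import Data.Fin using (Fin; toℕ)
open import Data.Bool using (Bool; true; false; _∧_; if_then_else_; not)
open import Data.Maybe using (Maybe; just; nothing)
open import Data.Vec using (Vec; []; _∷_; lookup; tabulate)
open import Data.List using (List; []; _∷_; map; concatMap; filterᵇ; length; allFin; upTo; product)

allB : {A : Set} → (A → Bool) → List A → Bool
allB p [] = true
allB p (x ∷ xs) = p x ∧ allB p xs

-- Vertices: Fin n, i.e. labels 0..n-1 (order-isomorphic to [n] = 1..n).
-- A (rooted) forest on Fin n is encoded by its parent vector:
-- entry v is  nothing  if v is a root, and  just u  if u is the parent of v.
Parents : ℕ → Set
Parents n = Vec (Maybe (Fin n)) n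

finEq : ∀ {n} → Fin n → Fin n → Bool
finEq a b = toℕ a ≡ᵇ toℕ b

maybeEq : ∀ {n} → Maybe (Fin n) → Maybe (Fin n) → Bool
maybeEq nothing  nothing  = true
maybeEq (just a) (just b) = finEq a b
maybeEq _        _        = false

isRoot : ∀ {n} → Parents n → Fin n → Bool
isRoot p v with lookup p v
... | nothing = true
... | just _  = false

climb : ∀ {n} → Parents n → ℕ → Fin n → Fin n
climb p zero    v = v
climb p (suc k) v with lookup p v
... | nothing = v
... | just u  = climb p k u

acyclic : ∀ {n} → Parents n → Bool
acyclic {n} p = allB (λ v → isRoot p (climb p n v)) (allFin n)

rootOf : ∀ {n} → Parents n → Fin n → Fin n
rootOf {n} p v = climb p n v

roots : ∀ {n} → Parents n → List (Fin n)
roots {n} p = filterᵇ (isRoot p) (allFin n)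

isRootedTree : ∀ {n} → Parents n → Bool
isRootedTree p = acyclic p ∧ (length (roots p) ≡ᵇ 1)

isRecord : ∀ {n} → Parents n → Fin n → Bool
isRecord {n} p v = allB (λ k → toℕ (climb p k v) ≤ᵇ toℕ v) (upTo (suc n))

bonsaiSeq : ∀ {n} → Parents n → Parents n
bonsaiSeq p = tabulate (λ v → if isRecord p v then nothing else lookup p v)

-- a bonsai sequence on Fin n (as a rooted forest whose trees are the bonsais B_i):
--  * acyclic;
--  * every vertex v has label ≤ the root of its tree (each tree is a bonsai);
--  * for roots r, r' with r' < r, every vertex of the tree of r' is < r
--    (the root of B_i exceeds all labels in B_1, ..., B_{i-1}).
isBonsaiSeq : ∀ {n} → Parents n → Bool
isBonsaiSeq {n} b =
  acyclic b
  ∧ allB (λ v → toℕ v ≤ᵇ toℕ (rootOf b v)) (allFin n)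
  ∧ allB (λ r → allB (λ v → if toℕ (rootOf b v) <ᵇ toℕ r then toℕ v <ᵇ toℕ r else true)
                   (allFin n))
        (roots b)

bonsaiType : ∀ {n} → Parents n → List ℕ
bonsaiType {n} b = map (λ r → length (filterᵇ (λ v → finEq (rootOf b v) r) (allFin n))) (roots b)

bracketFactorial : List ℕ → ℕ
bracketFactorial = go 0
  where
  go : ℕ → List ℕ → ℕ
  go acc []            = 1
  go acc (t ∷ [])      = 1
  go acc (t ∷ u ∷ ts)  = (acc + t) * go (acc + t) (u ∷ ts)

allVecs : (n m : ℕ) → List (Vec (Maybe (Fin n)) m)
allVecs n zero    = [] ∷ []
allVecs n (suc m) =
  concatMap (λ x → map (x ∷_) (allVecs n m)) (nothing ∷ map just (allFin n))

vecEq : ∀ {n m} → Vec (Maybe (Fin n)) m → Vec (Maybe (Fin n)) m → Bool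
vecEq [] [] = true
vecEq (x ∷ xs) (y ∷ ys) = maybeEq x y ∧ vecEq xs ys

numTreesWithBonsaiSeq : ∀ {n} → Parents n → ℕ
numTreesWithBonsaiSeq {n} b =
  length (filterᵇ (λ p → isRootedTree p ∧ vecEq (bonsaiSeq p) b) (allVecs n n))

{-# OPTIONS --safe #-}
module Submission where

open import Defs
open import Data.Nat using (ℕ; _≤_)
open import Data.Bool using (T)
open import Relation.Binary.PropositionalEquality using (_≡_)

open import Data.Bool using (Bool; true; false; _∧_; if_then_else_; T?)
open import Data.Bool.Properties using (T-∧; T-≡; ¬-not; if-eta)
open import Data.Empty using (⊥-elim)
open import Data.Fin as Fin using (Fin; toℕ; zero; suc; punchIn)
open import Data.Fin.Properties using (toℕ-injective; pigeonhole; punchIn-punchOut; toℕ<n)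
  renaming (_≟_ to _≟ᶠ_)
open import Data.List as List using (List; []; _∷_; map; concatMap; filterᵇ; length; allFin; upTo; _++_)
open import Data.List.Properties
  using (filter-++; filter-≐; filter-none; length-++; map-cong; map-cong-local; map-tabulate)
open import Data.List.Relation.Unary.All as All using (All; []; _∷_)
open import Data.List.Relation.Unary.All.Properties
  using (all-filter; applyUpTo⁺₁; applyUpTo⁻; tabulate⁺; tabulate⁻)
open import Data.List.Relation.Unary.AllPairs as AllPairs using (AllPairs; []; _∷_)
import Data.List.Relation.Unary.AllPairs.Properties as AllPairs
open import Data.Maybe using (Maybe; just; nothing)
open import Data.Maybe.Properties using (just-injective)
open import Data.Nat using (zero; suc; _+_; _*_; _∸_; _⊔_; _<_; z≤n; s≤s; _≡ᵇ_; _<ᵇ_; _≤?_)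
open import Data.Nat.ListAction using (sum; product)
open import Data.Nat.Properties
open import Data.Product using (∃; _×_; _,_; proj₁; proj₂)
open import Data.Sum using (inj₁; inj₂)
open import Data.Unit using (tt)
open import Data.Vec using (Vec; []; _∷_; lookup)
open import Data.Vec.Properties using (lookup∘tabulate; tabulate∘lookup; tabulate-cong)
open import Function using (_∘_; id; _⇔_; mk⇔; Equivalence)
open import Relation.Nullary using (¬_; yes; no; contradiction)
open import Relation.Binary.PropositionalEquality using (refl; sym; trans; cong; cong₂; subst; module ≡-Reasoning)

open Equivalence using (to; from)
open import Algebra.Properties.CommutativeMonoid.Sum +-0-commutativeMonoid
  using (sum-syntax; sum-cong-≗; sum-replicate-zero; sum-remove; ∑-comm)
open import Algebra.Properties.Semiring.Sum +-*-semiring using (*-distribʳ-sum)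

-- A rooted tree p has bonsai sequence b exactly when p keeps every edge of b and gives each root v
-- of b either no parent, which is possible only for the smallest root, or a parent u in a bonsai
-- whose root is smaller than v. For such p the bonsai root never increases along a path, so the
-- records of p are exactly the roots of b, and (bonsai root, depth) decreases along every edge, so p
-- is acyclic. Conversely, a root v of b that has a parent u in p is a record, and its path through u
-- climbs to the root of the bonsai of u, which must therefore be smaller than v.
-- The choices for different vertices are independent, and the root of the i-th bonsai has
-- t₁ + ⋯ + t_{i-1} choices (one if i = 1), whose product is [t]_{k-1}!.

iverson : Bool → ℕ
iverson true  = 1
iverson false = 0

T⇒iverson≡1 : ∀ {x} → T x → iverson x ≡ 1
T⇒iverson≡1 {true} _ = refl

iverson-≡ᵇ0+≡1⊔ : ∀ z → iverson (z ≡ᵇ 0) + z ≡ 1 ⊔ z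
iverson-≡ᵇ0+≡1⊔ zero    = refl
iverson-≡ᵇ0+≡1⊔ (suc z) = refl

descending-< : ∀ (a : ℕ → ℕ) {m} → (∀ {k} → k < m → a (suc k) < a k) →
  ∀ {i j} → i < j → j ≤ m → a j < a i
descending-< a step {i} {suc j} (s≤s i≤j) j<m with m≤n⇒m<n∨m≡n i≤j
... | inj₁ i<j  = <-trans (step j<m) (descending-< a step i<j (<⇒≤ j<m))
... | inj₂ refl = step j<m

lexicographic-< : ∀ {a b d} K → a < b → d < K → a * K + d < b * K
lexicographic-< {a} {b} {d} K a<b d<K = begin-strict
  a * K + d  <⟨ +-monoʳ-< (a * K) d<K ⟩
  a * K + K  ≡⟨ +-comm (a * K) K ⟩
  suc a * K  ≤⟨ *-monoˡ-≤ K a<b ⟩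
  b * K      ∎
  where open ≤-Reasoning

¬T⇒≡false : ∀ {x} → ¬ T x → x ≡ false
¬T⇒≡false ¬x = ¬-not (¬x ∘ from T-≡)

T-injective : ∀ {x y} → T x ⇔ T y → x ≡ y
T-injective {true}  {true}  _   = refl
T-injective {true}  {false} x⇔y = ⊥-elim (to x⇔y tt)
T-injective {false} {true}  x⇔y = ⊥-elim (from x⇔y tt)
T-injective {false} {false} _   = refl

finEq⇒≡ : ∀ {n} {a b : Fin n} → T (finEq a b) → a ≡ b
finEq⇒≡ {a = a} {b} h = toℕ-injective (≡ᵇ⇒≡ (toℕ a) (toℕ b) h)

finEq-refl : ∀ {n} (a : Fin n) → T (finEq a a)
finEq-refl a = ≡⇒≡ᵇ (toℕ a) (toℕ a) refl

maybeEq⇒≡ : ∀ {n} {x y : Maybe (Fin n)} → T (maybeEq x y) → x ≡ y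
maybeEq⇒≡ {x = nothing} {nothing} _ = refl
maybeEq⇒≡ {x = just a}  {just b}  h = cong just (finEq⇒≡ h)

maybeEq-refl : ∀ {n} (x : Maybe (Fin n)) → T (maybeEq x x)
maybeEq-refl nothing  = tt
maybeEq-refl (just a) = finEq-refl a

vecEq⇒≡ : ∀ {n m} {xs ys : Vec (Maybe (Fin n)) m} → T (vecEq xs ys) → xs ≡ ys
vecEq⇒≡ {xs = []}     {[]}     _ = refl
vecEq⇒≡ {xs = x ∷ xs} {y ∷ ys} h =
  let (x≈y , xs≈ys) = to T-∧ h in cong₂ _∷_ (maybeEq⇒≡ x≈y) (vecEq⇒≡ xs≈ys)

vecEq-refl : ∀ {n m} (xs : Vec (Maybe (Fin n)) m) → T (vecEq xs xs)
vecEq-refl []       = tt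
vecEq-refl (x ∷ xs) = from T-∧ (maybeEq-refl x , vecEq-refl xs)

allB⁺ : ∀ {A : Set} {f : A → Bool} {xs} → All (T ∘ f) xs → T (allB f xs)
allB⁺ []       = tt
allB⁺ (h ∷ hs) = from T-∧ (h , allB⁺ hs)

allB⁻ : ∀ {A : Set} {f : A → Bool} xs → T (allB f xs) → All (T ∘ f) xs
allB⁻ []       _ = []
allB⁻ (x ∷ xs) h = let (hx , hxs) = to T-∧ h in hx ∷ allB⁻ xs hxs

if-then-nothing≡just : ∀ {A : Set} c {m : Maybe A} {x} → (if c then nothing else m) ≡ just x → m ≡ just x
if-then-nothing≡just false eq = eq

if-then-nothing-else-just≡nothing : ∀ {A : Set} c {x : A} → (if c then nothing else just x) ≡ nothing → T c
if-then-nothing-else-just≡nothing true _ = tt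

-- Counting

countᵇ : ∀ {A : Set} → (A → Bool) → List A → ℕ
countᵇ f xs = length (filterᵇ f xs)

module _ {A : Set} where

  countᵇ-∷ : ∀ (f : A → Bool) x xs → countᵇ f (x ∷ xs) ≡ iverson (f x) + countᵇ f xs
  countᵇ-∷ f x xs with f x
  ... | true  = refl
  ... | false = refl

  countᵇ-++ : ∀ (f : A → Bool) xs ys → countᵇ f (xs ++ ys) ≡ countᵇ f xs + countᵇ f ys
  countᵇ-++ f xs ys = trans (cong length (filter-++ (T? ∘ f) xs ys)) (length-++ (filterᵇ f xs))

  countᵇ-concatMap : ∀ {B : Set} (f : A → Bool) (g : B → List A) xs →
    countᵇ f (concatMap g xs) ≡ sum (map (countᵇ f ∘ g) xs)
  countᵇ-concatMap f g []       = refl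
  countᵇ-concatMap f g (x ∷ xs) =
    trans (countᵇ-++ f (g x) (concatMap g xs)) (cong (countᵇ f (g x) +_) (countᵇ-concatMap f g xs))

  countᵇ-map : ∀ {B : Set} (f : A → Bool) (g : B → A) xs → countᵇ f (map g xs) ≡ countᵇ (f ∘ g) xs
  countᵇ-map f g []       = refl
  countᵇ-map f g (x ∷ xs) with f (g x)
  ... | true  = cong suc (countᵇ-map f g xs)
  ... | false = countᵇ-map f g xs

  countᵇ-cong : ∀ {f g : A → Bool} → (∀ x → f x ≡ g x) → ∀ xs → countᵇ f xs ≡ countᵇ g xs
  countᵇ-cong f≗g xs =
    cong length (filter-≐ (T? ∘ _) (T? ∘ _) (subst T (f≗g _) , subst T (sym (f≗g _))) xs)

  countᵇ-∧ : ∀ a (g : A → Bool) xs → countᵇ (λ x → a ∧ g x) xs ≡ iverson a * countᵇ g xs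
  countᵇ-∧ true  g xs = sym (+-identityʳ _)
  countᵇ-∧ false g xs = cong length (filter-none (T? ∘ λ _ → false) (All.universal (λ _ ()) xs))

  sum-iverson-* : ∀ (f : A → Bool) N xs → sum (map (λ x → iverson (f x) * N) xs) ≡ countᵇ f xs * N
  sum-iverson-* f N []       = refl
  sum-iverson-* f N (x ∷ xs) = begin
    iverson (f x) * N + sum (map (λ x → iverson (f x) * N) xs)
      ≡⟨ cong (iverson (f x) * N +_) (sum-iverson-* f N xs) ⟩
    iverson (f x) * N + countᵇ f xs * N
      ≡⟨ *-distribʳ-+ N (iverson (f x)) _ ⟨
    (iverson (f x) + countᵇ f xs) * N
      ≡⟨ cong (_* N) (countᵇ-∷ f x xs) ⟨
    countᵇ f (x ∷ xs) * N ∎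
    where open ≡-Reasoning

  sum-map-filterᵇ : ∀ (P : A → Bool) (f : A → ℕ) → (∀ x → ¬ T (P x) → f x ≡ 0) →
    ∀ xs → sum (map f (filterᵇ P xs)) ≡ sum (map f xs)
  sum-map-filterᵇ P f off []       = refl
  sum-map-filterᵇ P f off (x ∷ xs) with P x in Px
  ... | true  = cong (f x +_) (sum-map-filterᵇ P f off xs)
  ... | false = trans (sum-map-filterᵇ P f off xs) (cong (_+ sum (map f xs)) (sym (off x (subst T Px))))

  product-map-filterᵇ : ∀ (P : A → Bool) (f : A → ℕ) → (∀ x → ¬ T (P x) → f x ≡ 1) →
    ∀ xs → product (map f (filterᵇ P xs)) ≡ product (map f xs)
  product-map-filterᵇ P f off []       = refl
  product-map-filterᵇ P f off (x ∷ xs) with P x in Px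
  ... | true  = cong (f x *_) (product-map-filterᵇ P f off xs)
  ... | false = trans (product-map-filterᵇ P f off xs)
                  (trans (sym (*-identityˡ _)) (cong (_* product (map f xs)) (sym (off x (subst T Px)))))

sum-tabulate : ∀ {n} (f : Fin n → ℕ) → sum (List.tabulate f) ≡ ∑[ i < n ] f i
sum-tabulate {zero}  f = refl
sum-tabulate {suc n} f = cong (f zero +_) (sum-tabulate (f ∘ suc))

countᵇ-tabulate : ∀ {A : Set} {n} (f : A → Bool) (g : Fin n → A) →
  countᵇ f (List.tabulate g) ≡ ∑[ i < n ] iverson (f (g i))
countᵇ-tabulate {n = zero}  f g = refl
countᵇ-tabulate {n = suc n} f g =
  trans (countᵇ-∷ f (g zero) _) (cong (iverson (f (g zero)) +_) (countᵇ-tabulate f (g ∘ suc)))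

∑-δ : ∀ {n} (a : Fin n) (f : Fin n → ℕ) → ∑[ r < n ] (iverson (finEq a r) * f r) ≡ f a
∑-δ {suc n} zero    f = trans (cong₂ _+_ (+-identityʳ (f zero)) (sum-replicate-zero n)) (+-identityʳ (f zero))
∑-δ {suc n} (suc a) f = ∑-δ a (f ∘ suc)

∑-fibres : ∀ {m n} (ρ : Fin m → Fin n) (f : Fin n → ℕ) →
  ∑[ u < m ] f (ρ u) ≡ ∑[ r < n ] ((∑[ u < m ] iverson (finEq (ρ u) r)) * f r)
∑-fibres {m} {n} ρ f = begin
  ∑[ u < m ] f (ρ u)
    ≡⟨ sum-cong-≗ (λ u → ∑-δ (ρ u) f) ⟨
  ∑[ u < m ] ∑[ r < n ] (iverson (finEq (ρ u) r) * f r)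
    ≡⟨ ∑-comm (λ u r → iverson (finEq (ρ u) r) * f r) ⟩
  ∑[ r < n ] ∑[ u < m ] (iverson (finEq (ρ u) r) * f r)
    ≡⟨ sum-cong-≗ (λ r → *-distribʳ-sum (f r) (λ u → iverson (finEq (ρ u) r))) ⟨
  ∑[ r < n ] ((∑[ u < m ] iverson (finEq (ρ u) r)) * f r) ∎
  where open ≡-Reasoning

0<∑-iverson : ∀ {n} (f : Fin n → Bool) {i} → T (f i) → 0 < ∑[ j < n ] iverson (f j)
0<∑-iverson {suc n} f {zero}  fi = ≤-trans (≤-reflexive (sym (T⇒iverson≡1 fi))) (m≤m+n _ _)
0<∑-iverson {suc n} f {suc i} fi = ≤-trans (0<∑-iverson (f ∘ suc) fi) (m≤n+m _ _)

∑-iverson-none : ∀ {n} (f : Fin n → Bool) → (∀ i → ¬ T (f i)) → ∑[ i < n ] iverson (f i) ≡ 0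
∑-iverson-none {n} f none = trans (sum-cong-≗ (λ i → cong iverson (¬T⇒≡false (none i)))) (sum-replicate-zero n)

∑-iverson-single : ∀ {n} (f : Fin n → Bool) {a} → T (f a) → (∀ {i} → T (f i) → i ≡ a) →
  ∑[ i < n ] iverson (f i) ≡ 1
∑-iverson-single {n} f {a} fa unique = begin
  ∑[ i < n ] iverson (f i)               ≡⟨ sum-cong-≗ (λ i → cong iverson (T-injective (f⇔δ i))) ⟩
  ∑[ i < n ] iverson (finEq a i)         ≡⟨ sum-cong-≗ (λ i → *-identityʳ (iverson (finEq a i))) ⟨
  ∑[ i < n ] (iverson (finEq a i) * 1)   ≡⟨ ∑-δ a (λ _ → 1) ⟩
  1                                      ∎
  where
  open ≡-Reasoning
  f⇔δ : ∀ i → T (f i) ⇔ T (finEq a i)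
  f⇔δ i = mk⇔ (λ fi → subst (T ∘ finEq a) (sym (unique fi)) (finEq-refl a))
              (λ δ → subst (T ∘ f) (finEq⇒≡ δ) fa)

∑-iverson≡1⇒unique : ∀ {n} (f : Fin n → Bool) → ∑[ i < n ] iverson (f i) ≡ 1 →
  ∀ {i j} → T (f i) → T (f j) → i ≡ j
∑-iverson≡1⇒unique {suc n} f total {i} {j} fi fj with i ≟ᶠ j
... | yes i≡j = i≡j
... | no  i≢j = contradiction total (>⇒≢ (begin-strict
  1                             <⟨ +-monoʳ-< 1 (0<∑-iverson (f ∘ punchIn i) fj′) ⟩
  1 + rest                      ≡⟨ cong (_+ rest) (T⇒iverson≡1 fi) ⟨
  iverson (f i) + rest          ≡⟨ sum-remove (iverson ∘ f) ⟨
  ∑[ k < suc n ] iverson (f k)  ∎))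
  where
  open ≤-Reasoning
  rest : ℕ
  rest = ∑[ k < n ] iverson (f (punchIn i k))
  fj′ : T (f (punchIn i (Fin.punchOut i≢j)))
  fj′ = subst (T ∘ f) (sym (punchIn-punchOut i≢j)) fj

choices : (n : ℕ) → List (Maybe (Fin n))
choices n = nothing ∷ map just (allFin n)

countᵇ-choices : ∀ {n} (q : Maybe (Fin n) → Bool) →
  countᵇ q (choices n) ≡ iverson (q nothing) + ∑[ u < n ] iverson (q (just u))
countᵇ-choices {n} q = trans (countᵇ-∷ q nothing _)
  (cong (iverson (q nothing) +_) (trans (countᵇ-map q just (allFin n)) (countᵇ-tabulate (q ∘ just) id)))

everyEntry : ∀ {n m} → (Fin m → Maybe (Fin n) → Bool) → Vec (Maybe (Fin n)) m → Bool
everyEntry qs []       = true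
everyEntry qs (x ∷ xs) = qs zero x ∧ everyEntry (qs ∘ suc) xs

everyEntry⁺ : ∀ {n m} {qs : Fin m → Maybe (Fin n) → Bool} (xs : Vec (Maybe (Fin n)) m) →
  (∀ i → T (qs i (lookup xs i))) → T (everyEntry qs xs)
everyEntry⁺ []       h = tt
everyEntry⁺ (x ∷ xs) h = from T-∧ (h zero , everyEntry⁺ xs (h ∘ suc))

everyEntry⁻ : ∀ {n m} {qs : Fin m → Maybe (Fin n) → Bool} (xs : Vec (Maybe (Fin n)) m) →
  T (everyEntry qs xs) → ∀ i → T (qs i (lookup xs i))
everyEntry⁻ (x ∷ xs) h zero    = proj₁ (to T-∧ h)
everyEntry⁻ (x ∷ xs) h (suc i) = everyEntry⁻ xs (proj₂ (to T-∧ h)) i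

countᵇ-everyEntry-allVecs : ∀ n m (qs : Fin m → Maybe (Fin n) → Bool) →
  countᵇ (everyEntry qs) (allVecs n m) ≡ product (List.tabulate (λ i → countᵇ (qs i) (choices n)))
countᵇ-everyEntry-allVecs n zero    qs = refl
countᵇ-everyEntry-allVecs n (suc m) qs = begin
  countᵇ (everyEntry qs) (concatMap extend (choices n))
    ≡⟨ countᵇ-concatMap (everyEntry qs) extend (choices n) ⟩
  sum (map (countᵇ (everyEntry qs) ∘ extend) (choices n))
    ≡⟨ cong sum (map-cong countᵇ-extend (choices n)) ⟩
  sum (map (λ x → iverson (qs zero x) * rest) (choices n))
    ≡⟨ sum-iverson-* (qs zero) rest (choices n) ⟩
  countᵇ (qs zero) (choices n) * rest
    ≡⟨ cong (countᵇ (qs zero) (choices n) *_) (countᵇ-everyEntry-allVecs n m (qs ∘ suc)) ⟩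
  countᵇ (qs zero) (choices n) * product (List.tabulate (λ i → countᵇ (qs (suc i)) (choices n))) ∎
  where
  open ≡-Reasoning
  extend : Maybe (Fin n) → List (Vec (Maybe (Fin n)) (suc m))
  extend x = map (x ∷_) (allVecs n m)
  rest : ℕ
  rest = countᵇ (everyEntry (qs ∘ suc)) (allVecs n m)
  countᵇ-extend : ∀ x → countᵇ (everyEntry qs) (extend x) ≡ iverson (qs zero x) * rest
  countᵇ-extend x = trans (countᵇ-map (everyEntry qs) (x ∷_) (allVecs n m))
                          (countᵇ-∧ (qs zero x) (everyEntry (qs ∘ suc)) (allVecs n m))

-- Parent vectors

_⊑_ : ∀ {n} → Parents n → Parents n → Set
p ⊑ q = ∀ {v u} → lookup p v ≡ just u → lookup q v ≡ just u

module _ {n : ℕ} (p : Parents n) where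

  isRoot⁺ : ∀ {v} → lookup p v ≡ nothing → T (isRoot p v)
  isRoot⁺ eq rewrite eq = tt

  isRoot⁻ : ∀ {v} → T (isRoot p v) → lookup p v ≡ nothing
  isRoot⁻ {v} h with lookup p v
  ... | nothing = refl

  climb-root : ∀ {v} → lookup p v ≡ nothing → ∀ k → climb p k v ≡ v
  climb-root eq zero    = refl
  climb-root eq (suc k) rewrite eq = refl

  climb-parent : ∀ {v u} → lookup p v ≡ just u → ∀ k → climb p (suc k) v ≡ climb p k u
  climb-parent eq k rewrite eq = refl

  climb-+ : ∀ k j v → climb p (k + j) v ≡ climb p j (climb p k v)
  climb-+ zero    j v = refl
  climb-+ (suc k) j v with lookup p v in eq
  ... | nothing = sym (climb-root eq j)
  ... | just u  = climb-+ k j u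

  climb-stable : ∀ {k m v} → k ≤ m → lookup p (climb p k v) ≡ nothing → climb p m v ≡ climb p k v
  climb-stable {k} {m} {v} k≤m eq = begin
    climb p m v                    ≡⟨ cong (λ i → climb p i v) (m+[n∸m]≡n k≤m) ⟨
    climb p (k + (m ∸ k)) v        ≡⟨ climb-+ k (m ∸ k) v ⟩
    climb p (m ∸ k) (climb p k v)  ≡⟨ climb-root eq (m ∸ k) ⟩
    climb p k v                    ∎
    where open ≡-Reasoning

  climb-suc : ∀ {k v u} → lookup p (climb p k v) ≡ just u → climb p (suc k) v ≡ u
  climb-suc {k} {v} {u} eq = begin
    climb p (suc k) v        ≡⟨ cong (λ i → climb p i v) (+-comm 1 k) ⟩
    climb p (k + 1) v        ≡⟨ climb-+ k 1 v ⟩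
    climb p 1 (climb p k v)  ≡⟨ climb-parent eq 0 ⟩
    u                        ∎
    where open ≡-Reasoning

  Acyclic : Set
  Acyclic = ∀ v → lookup p (rootOf p v) ≡ nothing

  acyclic⁺ : Acyclic → T (acyclic p)
  acyclic⁺ acyc = allB⁺ (tabulate⁺ (λ v → isRoot⁺ (acyc v)))

  acyclic⁻ : T (acyclic p) → Acyclic
  acyclic⁻ h v = isRoot⁻ (tabulate⁻ (allB⁻ (allFin n) h) v)

  acyclic-byPotential : (φ : Fin n → ℕ) → (∀ {v u} → lookup p v ≡ just u → φ u < φ v) → Acyclic
  acyclic-byPotential φ φ-decreasing v with lookup p (rootOf p v) in last
  ... | nothing = refl
  ... | just _
    with i , j , i<j , climbᵢ≡climbⱼ ← pigeonhole (n<1+n n) (λ k → climb p (toℕ k) v)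
    = contradiction (cong φ climbᵢ≡climbⱼ)
        (>⇒≢ (descending-< (λ k → φ (climb p k v)) φ-step i<j (≤-pred (toℕ<n j))))
    where
    nonRoot : ∀ {k} → k ≤ n → ∃ λ u → lookup p (climb p k v) ≡ just u
    nonRoot {k} k≤n with lookup p (climb p k v) in eq
    ... | just u  = u , refl
    ... | nothing with () ← trans (sym (trans (cong (lookup p) (climb-stable k≤n eq)) eq)) last
    φ-step : ∀ {k} → k < n → φ (climb p (suc k) v) < φ (climb p k v)
    φ-step {k} k<n with u , eq ← nonRoot (<⇒≤ k<n) =
      subst (λ w → φ w < φ (climb p k v)) (sym (climb-suc eq)) (φ-decreasing eq)

  returning⇒root : Acyclic → ∀ {d v} → climb p (suc d) v ≡ v → lookup p v ≡ nothing
  returning⇒root acyc {d} {v} loop = subst (λ w → lookup p w ≡ nothing) (sym v≡rootOf) (acyc v)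
    where
    iterate : ∀ j → climb p (j * suc d) v ≡ v
    iterate zero    = refl
    iterate (suc j) = trans (climb-+ (suc d) (j * suc d) v) (trans (cong (climb p (j * suc d)) loop) (iterate j))
    v≡rootOf : v ≡ rootOf p v
    v≡rootOf = trans (sym (iterate n)) (climb-stable (m≤m*n n (suc d)) (acyc v))

  rootOf-root : ∀ {r} → lookup p r ≡ nothing → rootOf p r ≡ r
  rootOf-root eq = climb-root eq n

  rootOf-parent : Acyclic → ∀ {v u} → lookup p v ≡ just u → rootOf p u ≡ rootOf p v
  rootOf-parent acyc {v} eq = trans (sym (climb-parent eq n)) (climb-stable (n≤1+n n) (acyc v))

  steps : ℕ → Fin n → ℕ
  steps zero    v = 0
  steps (suc k) v with lookup p v
  ... | nothing = 0
  ... | just u  = suc (steps k u)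

  steps-≤ : ∀ k v → steps k v ≤ k
  steps-≤ zero    v = z≤n
  steps-≤ (suc k) v with lookup p v
  ... | nothing = z≤n
  ... | just u  = s≤s (steps-≤ k u)

  steps-root : ∀ {v} → lookup p v ≡ nothing → ∀ k → steps k v ≡ 0
  steps-root eq zero    = refl
  steps-root eq (suc k) rewrite eq = refl

  steps-stable : ∀ k j v → lookup p (climb p k v) ≡ nothing → steps (k + j) v ≡ steps k v
  steps-stable zero    j v eq = steps-root eq j
  steps-stable (suc k) j v eq with lookup p v
  ... | nothing = refl
  ... | just u  = cong suc (steps-stable k j u eq)

  depth : Fin n → ℕ
  depth = steps n

  depth-parent : Acyclic → ∀ {v u} → lookup p v ≡ just u → depth v ≡ suc (depth u)
  depth-parent acyc {v} {u} eq = begin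
    steps n v        ≡⟨ steps-stable n 1 v (acyc v) ⟨
    steps (n + 1) v  ≡⟨ cong (λ k → steps k v) (+-comm n 1) ⟩
    steps (suc n) v  ≡⟨ steps-parent ⟩
    suc (steps n u)  ∎
    where
    open ≡-Reasoning
    steps-parent : steps (suc n) v ≡ suc (steps n u)
    steps-parent rewrite eq = refl

  isRecord⁺ : ∀ {v} → (∀ {k} → k ≤ n → toℕ (climb p k v) ≤ toℕ v) → T (isRecord p v)
  isRecord⁺ bounded = allB⁺ (applyUpTo⁺₁ id (suc n) (λ k<1+n → ≤⇒≤ᵇ (bounded (≤-pred k<1+n))))

  isRecord⁻ : ∀ {v} → T (isRecord p v) → ∀ {k} → k ≤ n → toℕ (climb p k v) ≤ toℕ v
  isRecord⁻ rec k≤n = ≤ᵇ⇒≤ _ _ (applyUpTo⁻ id (suc n) (allB⁻ (upTo (suc n)) rec) (s≤s k≤n))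

  record-climb-≤ : Acyclic → ∀ {v} → T (isRecord p v) → ∀ k → toℕ (climb p k v) ≤ toℕ v
  record-climb-≤ acyc {v} rec k with k ≤? n
  ... | yes k≤n = isRecord⁻ rec k≤n
  ... | no  k≰n =
    subst (λ w → toℕ w ≤ toℕ v) (sym (climb-stable (<⇒≤ (≰⇒> k≰n)) (acyc v))) (isRecord⁻ rec ≤-refl)

  roots-sorted : AllPairs Fin._<_ (roots p)
  roots-sorted = AllPairs.filter⁺ (T? ∘ isRoot p) (AllPairs.tabulate⁺-< id)

  roots-areRoots : All (λ r → lookup p r ≡ nothing) (roots p)
  roots-areRoots = All.map isRoot⁻ (all-filter (T? ∘ isRoot p) (allFin n))

climb-⊑ : ∀ {n} {p q : Parents n} → p ⊑ q → ∀ k w → climb q (steps p k w) w ≡ climb p k w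
climb-⊑         p⊑q zero    w = refl
climb-⊑ {p = p} {q} p⊑q (suc k) w with lookup p w in eq
... | nothing = refl
... | just u  = trans (climb-parent q (p⊑q eq) (steps p k u)) (climb-⊑ p⊑q k u)

-- Bracket factorials

bracketFactorial-∷-∷ : ∀ x y ts → bracketFactorial (x ∷ y ∷ ts) ≡ x * bracketFactorial (x + y ∷ ts)
bracketFactorial-∷-∷ x y []      = refl
bracketFactorial-∷-∷ x y (_ ∷ _) = refl

module _ {n} (t : Fin n → ℕ) where

  weightBelow : List (Fin n) → Fin n → ℕ
  weightBelow rs r = sum (map (λ r′ → t r′ * iverson (toℕ r′ <ᵇ toℕ r)) rs)

  weightBelow-∷-< : ∀ {r₁ r} rs → r₁ Fin.< r → weightBelow (r₁ ∷ rs) r ≡ t r₁ + weightBelow rs r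
  weightBelow-∷-< {r₁} {r} rs r₁<r =
    cong (_+ weightBelow rs r)
      (trans (cong (λ x → t r₁ * iverson x) (to T-≡ (<⇒<ᵇ r₁<r))) (*-identityʳ (t r₁)))

  weightBelow-least : ∀ {r rs} → All (r Fin.≤_) rs → weightBelow rs r ≡ 0
  weightBelow-least         []            = refl
  weightBelow-least {r} {r′ ∷ _} (r≤r′ ∷ r≤rs) = cong₂ _+_
    (trans (cong (λ x → t r′ * iverson x) (¬T⇒≡false (≤⇒≯ r≤r′ ∘ <ᵇ⇒< _ _))) (*-zeroʳ (t r′)))
    (weightBelow-least r≤rs)

  product-acc+weightBelow : ∀ acc {rs} → AllPairs Fin._<_ rs →
    product (map (λ r → acc + weightBelow rs r) rs) ≡ bracketFactorial (acc ∷ map t rs)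
  product-acc+weightBelow acc []                          = refl
  product-acc+weightBelow acc {r₁ ∷ rs} (r₁<rs ∷ sorted) = begin
    (acc + weightBelow (r₁ ∷ rs) r₁) * product (map (λ r → acc + weightBelow (r₁ ∷ rs) r) rs)
      ≡⟨ cong₂ _*_ first (cong product (map-cong-local (All.map shift r₁<rs))) ⟩
    acc * product (map (λ r → (acc + t r₁) + weightBelow rs r) rs)
      ≡⟨ cong (acc *_) (product-acc+weightBelow (acc + t r₁) sorted) ⟩
    acc * bracketFactorial (acc + t r₁ ∷ map t rs)
      ≡⟨ bracketFactorial-∷-∷ acc (t r₁) (map t rs) ⟨
    bracketFactorial (acc ∷ t r₁ ∷ map t rs) ∎
    where
    open ≡-Reasoning
    first : acc + weightBelow (r₁ ∷ rs) r₁ ≡ acc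
    first = trans (cong (acc +_) (weightBelow-least (≤-refl ∷ All.map <⇒≤ r₁<rs))) (+-identityʳ acc)
    shift : ∀ {r} → r₁ Fin.< r → acc + weightBelow (r₁ ∷ rs) r ≡ (acc + t r₁) + weightBelow rs r
    shift r₁<r = trans (cong (acc +_) (weightBelow-∷-< rs r₁<r)) (sym (+-assoc acc (t r₁) _))

  product-1⊔weightBelow : ∀ {rs} → AllPairs Fin._<_ rs → All (λ r → 0 < t r) rs →
    product (map (λ r → 1 ⊔ weightBelow rs r) rs) ≡ bracketFactorial (map t rs)
  product-1⊔weightBelow []                      _              = refl
  product-1⊔weightBelow {r₁ ∷ rs} (r₁<rs ∷ sorted) (0<t₁ ∷ _) = begin
    (1 ⊔ weightBelow (r₁ ∷ rs) r₁) * product (map (λ r → 1 ⊔ weightBelow (r₁ ∷ rs) r) rs)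
      ≡⟨ cong₂ _*_ first (cong product (map-cong-local (All.map shift r₁<rs))) ⟩
    1 * product (map (λ r → t r₁ + weightBelow rs r) rs)
      ≡⟨ *-identityˡ _ ⟩
    product (map (λ r → t r₁ + weightBelow rs r) rs)
      ≡⟨ product-acc+weightBelow (t r₁) sorted ⟩
    bracketFactorial (t r₁ ∷ map t rs) ∎
    where
    open ≡-Reasoning
    first : 1 ⊔ weightBelow (r₁ ∷ rs) r₁ ≡ 1
    first = cong (1 ⊔_) (weightBelow-least (≤-refl ∷ All.map <⇒≤ r₁<rs))
    shift : ∀ {r} → r₁ Fin.< r → 1 ⊔ weightBelow (r₁ ∷ rs) r ≡ t r₁ + weightBelow rs r
    shift r₁<r = trans (cong (1 ⊔_) (weightBelow-∷-< rs r₁<r)) (m≤n⇒m⊔n≡n (≤-trans 0<t₁ (m≤m+n _ _)))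

-- Trees with a given bonsai sequence

isBonsaiSeq⁻ : ∀ {n} (b : Parents n) → T (isBonsaiSeq b) → Acyclic b × (∀ v → toℕ v ≤ toℕ (rootOf b v))
isBonsaiSeq⁻ {n} b h =
  let (acyc , bonsais∧ordered) = to T-∧ h
      (bonsais , _) = to T-∧ bonsais∧ordered
  in acyclic⁻ b acyc , λ v → ≤ᵇ⇒≤ _ _ (tabulate⁻ (allB⁻ (allFin n) bonsais) v)

module BonsaiSequence {n : ℕ} (b : Parents n) (b-acyclic : Acyclic b)
  (≤-rootOf : ∀ v → toℕ v ≤ toℕ (rootOf b v)) where

  below : Fin n → ℕ
  below v = ∑[ u < n ] iverson (toℕ (rootOf b u) <ᵇ toℕ v)

  0<below : ∀ {u v} → toℕ (rootOf b u) < toℕ v → 0 < below v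
  0<below {v = v} lt = 0<∑-iverson (λ u → toℕ (rootOf b u) <ᵇ toℕ v) (<⇒<ᵇ lt)

  below≡0⇒≤ : ∀ {r v} → lookup b r ≡ nothing → below v ≡ 0 → toℕ v ≤ toℕ r
  below≡0⇒≤ {r} {v} r-root below≡0 = ≮⇒≥ λ r<v →
    >⇒≢ (0<below (subst (λ w → toℕ w < toℕ v) (sym (rootOf-root b r-root)) r<v)) below≡0

  -- The parents v may have in a tree with bonsai sequence b; below v ≡ 0 singles out the smallest
  -- root of b, which has to stay the root of the tree.
  admissibleAt : Maybe (Fin n) → Fin n → Maybe (Fin n) → Bool
  admissibleAt (just x) v y        = maybeEq y (just x)
  admissibleAt nothing  v nothing  = below v ≡ᵇ 0
  admissibleAt nothing  v (just u) = toℕ (rootOf b u) <ᵇ toℕ v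

  admissible : Fin n → Maybe (Fin n) → Bool
  admissible v = admissibleAt (lookup b v) v

  module Regrafting (p : Parents n) (b⊑p : b ⊑ p)
    (descends : ∀ {v u} → lookup b v ≡ nothing → lookup p v ≡ just u → toℕ (rootOf b u) < toℕ v) where

    rootOf-parent-≤ : ∀ {v u} → lookup p v ≡ just u → toℕ (rootOf b u) ≤ toℕ (rootOf b v)
    rootOf-parent-≤ {v} {u} eq with lookup b v in eb
    ... | just x  = ≤-reflexive (cong toℕ (trans (cong (rootOf b) (just-injective (trans (sym eq) (b⊑p eb))))
                                                 (rootOf-parent b b-acyclic eb)))
    ... | nothing = subst (λ w → toℕ (rootOf b u) ≤ toℕ w) (sym (rootOf-root b eb)) (<⇒≤ (descends eb eq))

    rootOf-climb-≤ : ∀ k v → toℕ (rootOf b (climb p k v)) ≤ toℕ (rootOf b v)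
    rootOf-climb-≤ zero    v = ≤-refl
    rootOf-climb-≤ (suc k) v with lookup p v in eq
    ... | nothing = ≤-refl
    ... | just u  = ≤-trans (rootOf-climb-≤ k u) (rootOf-parent-≤ eq)

    root⇒record : ∀ {v} → lookup b v ≡ nothing → T (isRecord p v)
    root⇒record {v} eq = isRecord⁺ p λ {k} _ → subst (λ w → toℕ (climb p k v) ≤ toℕ w) (rootOf-root b eq)
      (≤-trans (≤-rootOf (climb p k v)) (rootOf-climb-≤ k v))

    nonroot⇒¬record : ∀ {v x} → lookup b v ≡ just x → ¬ T (isRecord p v)
    nonroot⇒¬record {v} eq rec = contradiction (trans (sym eq) v-root) λ ()
      where
      rootOf≤v : toℕ (rootOf b v) ≤ toℕ v
      rootOf≤v = subst (λ w → toℕ w ≤ toℕ v) (climb-⊑ b⊑p n v) (isRecord⁻ p rec (steps-≤ b n v))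
      v-root : lookup b v ≡ nothing
      v-root = subst (λ w → lookup b w ≡ nothing)
                     (toℕ-injective (≤-antisym rootOf≤v (≤-rootOf v))) (b-acyclic v)

    bonsaiSeq-regrafted : bonsaiSeq p ≡ b
    bonsaiSeq-regrafted = trans (tabulate-cong entry) (tabulate∘lookup b)
      where
      entry : ∀ v → (if isRecord p v then nothing else lookup p v) ≡ lookup b v
      entry v with lookup b v in eb
      ... | just x  rewrite ¬T⇒≡false (nonroot⇒¬record eb) = b⊑p eb
      ... | nothing rewrite to T-≡ (root⇒record eb)        = refl

    -- Edges of b keep the bonsai root and lower the depth; regrafted edges lower the bonsai root.
    potential : Fin n → ℕ
    potential v = toℕ (rootOf b v) * suc n + depth b v

    potential-decreasing : ∀ {v u} → lookup p v ≡ just u → potential u < potential v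
    potential-decreasing {v} {u} eq with lookup b v in eb
    ... | just x  = begin-strict
      potential u
        ≡⟨ cong potential (just-injective (trans (sym eq) (b⊑p eb))) ⟩
      toℕ (rootOf b x) * suc n + depth b x
        ≡⟨ cong (λ w → toℕ w * suc n + depth b x) (rootOf-parent b b-acyclic eb) ⟩
      toℕ (rootOf b v) * suc n + depth b x
        <⟨ +-monoʳ-< (toℕ (rootOf b v) * suc n) (n<1+n (depth b x)) ⟩
      toℕ (rootOf b v) * suc n + suc (depth b x)
        ≡⟨ cong (toℕ (rootOf b v) * suc n +_) (depth-parent b b-acyclic eb) ⟨
      potential v ∎
      where open ≤-Reasoning
    ... | nothing = begin-strict
      potential u
        <⟨ lexicographic-< (suc n) (descends eb eq) (s≤s (steps-≤ b n u)) ⟩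
      toℕ v * suc n
        ≡⟨ +-identityʳ (toℕ v * suc n) ⟨
      toℕ v * suc n + 0
        ≡⟨ cong₂ (λ w d → toℕ w * suc n + d) (rootOf-root b eb) (steps-root b eb n) ⟨
      potential v ∎
      where open ≤-Reasoning

    acyclic-regrafted : Acyclic p
    acyclic-regrafted = acyclic-byPotential p potential potential-decreasing

  module FromTree (p : Parents n) (tree : T (isRootedTree p)) (seq : bonsaiSeq p ≡ b) where

    p-acyclic : Acyclic p
    p-acyclic = acyclic⁻ p (proj₁ (to T-∧ tree))

    root-unique : ∀ {r r′} → lookup p r ≡ nothing → lookup p r′ ≡ nothing → r ≡ r′
    root-unique r-root r′-root = ∑-iverson≡1⇒unique (isRoot p)
      (trans (sym (countᵇ-tabulate (isRoot p) id)) (≡ᵇ⇒≡ _ 1 (proj₂ (to T-∧ tree))))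
      (isRoot⁺ p r-root) (isRoot⁺ p r′-root)

    bonsaiSeq-entry : ∀ v → (if isRecord p v then nothing else lookup p v) ≡ lookup b v
    bonsaiSeq-entry v = trans (sym (lookup∘tabulate _ v)) (cong (λ s → lookup s v) seq)

    b⊑p : b ⊑ p
    b⊑p {v} eq = if-then-nothing≡just (isRecord p v) (trans (bonsaiSeq-entry v) eq)

    regrafted⇒record : ∀ {v u} → lookup b v ≡ nothing → lookup p v ≡ just u → T (isRecord p v)
    regrafted⇒record {v} eb ep = if-then-nothing-else-just≡nothing (isRecord p v)
      (trans (cong (λ y → if isRecord p v then nothing else y) (sym ep)) (trans (bonsaiSeq-entry v) eb))

    descends : ∀ {v u} → lookup b v ≡ nothing → lookup p v ≡ just u → toℕ (rootOf b u) < toℕ v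
    -- v is a record whose path through u reaches rootOf b u; equality would put v on a cycle.
    descends {v} {u} eb ep = ≤∧≢⇒< rootOf≤v λ rootOf≡v →
      contradiction (trans (sym ep) (returning⇒root p p-acyclic (trans reaches (toℕ-injective rootOf≡v)))) λ ()
      where
      reaches : climb p (suc (depth b u)) v ≡ rootOf b u
      reaches = trans (climb-parent p ep (depth b u)) (climb-⊑ b⊑p n u)
      rootOf≤v : toℕ (rootOf b u) ≤ toℕ v
      rootOf≤v = subst (λ w → toℕ w ≤ toℕ v) reaches (record-climb-≤ p p-acyclic (regrafted⇒record eb ep) _)

    open Regrafting p b⊑p descends using (rootOf-climb-≤)

    root⇒below≡0 : ∀ {ρ} → lookup p ρ ≡ nothing → below ρ ≡ 0
    root⇒below≡0 {ρ} ρ-root = ∑-iverson-none _ λ u lt → <⇒≱ (<ᵇ⇒< _ _ lt) (ρ≤rootOf u)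
      where
      ρ-bonsaiRoot : lookup b ρ ≡ nothing
      ρ-bonsaiRoot = begin
        lookup b ρ                                        ≡⟨ bonsaiSeq-entry ρ ⟨
        (if isRecord p ρ then nothing else lookup p ρ)    ≡⟨ cong (λ y → if isRecord p ρ then nothing else y) ρ-root ⟩
        (if isRecord p ρ then nothing else nothing)       ≡⟨ if-eta (isRecord p ρ) ⟩
        nothing                                           ∎
        where open ≡-Reasoning
      ρ≤rootOf : ∀ u → toℕ ρ ≤ toℕ (rootOf b u)
      ρ≤rootOf u = begin
        toℕ ρ                        ≡⟨ cong toℕ (rootOf-root b ρ-bonsaiRoot) ⟨
        toℕ (rootOf b ρ)             ≡⟨ cong (toℕ ∘ rootOf b) (root-unique ρ-root (p-acyclic u)) ⟩
        toℕ (rootOf b (rootOf p u))  ≤⟨ rootOf-climb-≤ n u ⟩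
        toℕ (rootOf b u)             ∎
        where open ≤-Reasoning

    admissible-tree : ∀ v → T (admissible v (lookup p v))
    admissible-tree v with lookup b v in eb
    ... | just x  = subst (λ y → T (maybeEq y (just x))) (sym (b⊑p eb)) (maybeEq-refl (just x))
    ... | nothing with lookup p v in ep
    ...   | nothing = ≡⇒≡ᵇ _ 0 (root⇒below≡0 ep)
    ...   | just u  = <⇒<ᵇ (descends eb ep)

  module FromAdmissible (p : Parents n) (adm : ∀ v → T (admissible v (lookup p v))) where

    adm-root : ∀ {v} → lookup b v ≡ nothing → T (admissibleAt nothing v (lookup p v))
    adm-root {v} eb = subst (λ m → T (admissibleAt m v (lookup p v))) eb (adm v)

    b⊑p : b ⊑ p
    b⊑p {v} eb = maybeEq⇒≡ (subst (λ m → T (admissibleAt m v (lookup p v))) eb (adm v))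

    descends : ∀ {v u} → lookup b v ≡ nothing → lookup p v ≡ just u → toℕ (rootOf b u) < toℕ v
    descends {v} eb ep = <ᵇ⇒< _ _ (subst (T ∘ admissibleAt nothing v) ep (adm-root eb))

    root⇒below≡0 : ∀ {v} → lookup p v ≡ nothing → lookup b v ≡ nothing × below v ≡ 0
    root⇒below≡0 {v} ep with lookup b v in eb
    ... | just x  = contradiction (trans (sym ep) (b⊑p eb)) λ ()
    ... | nothing = refl , ≡ᵇ⇒≡ _ 0 (subst (T ∘ admissibleAt nothing v) ep (adm-root eb))

    root-unique : ∀ {r r′} → lookup p r ≡ nothing → lookup p r′ ≡ nothing → r ≡ r′
    root-unique r-root r′-root =
      let (r-bonsaiRoot , below-r≡0) = root⇒below≡0 r-root
          (r′-bonsaiRoot , below-r′≡0) = root⇒below≡0 r′-root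
      in toℕ-injective (≤-antisym (below≡0⇒≤ r′-bonsaiRoot below-r≡0)
                                  (below≡0⇒≤ r-bonsaiRoot below-r′≡0))

    open Regrafting p b⊑p descends using (acyclic-regrafted; bonsaiSeq-regrafted)

    tree-with-bonsaiSeq : Fin n → T (isRootedTree p ∧ vecEq (bonsaiSeq p) b)
    tree-with-bonsaiSeq v₀ = from T-∧ (from T-∧ (acyclic⁺ p acyclic-regrafted , ≡⇒≡ᵇ _ 1 one-root) ,
      subst (T ∘ vecEq (bonsaiSeq p)) bonsaiSeq-regrafted (vecEq-refl (bonsaiSeq p)))
      where
      one-root : length (roots p) ≡ 1
      one-root = trans (countᵇ-tabulate (isRoot p) id) (∑-iverson-single (isRoot p)
        (isRoot⁺ p (acyclic-regrafted v₀))
        (λ r-root → root-unique (isRoot⁻ p r-root) (acyclic-regrafted v₀)))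

  -- The vertex v₀ provides the root rootOf p v₀; for n = 0 no vector is a rooted tree.
  treeWithBonsaiSeq≡everyEntry-admissible : Fin n → ∀ p →
    (isRootedTree p ∧ vecEq (bonsaiSeq p) b) ≡ everyEntry admissible p
  treeWithBonsaiSeq≡everyEntry-admissible v₀ p = T-injective (mk⇔
    (λ h → let (tree , seq) = to T-∧ h in everyEntry⁺ p (FromTree.admissible-tree p tree (vecEq⇒≡ seq)))
    (λ h → FromAdmissible.tree-with-bonsaiSeq p (everyEntry⁻ p h) v₀))

  size : Fin n → ℕ
  size r = countᵇ (λ v → finEq (rootOf b v) r) (allFin n)

  0<size : ∀ {r} → lookup b r ≡ nothing → 0 < size r
  0<size {r} r-root = subst (0 <_) (sym (countᵇ-tabulate (λ v → finEq (rootOf b v) r) id))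
    (0<∑-iverson (λ v → finEq (rootOf b v) r)
                 (subst (λ w → T (finEq w r)) (sym (rootOf-root b r-root)) (finEq-refl r)))

  size-nonroot : ∀ {r} → ¬ T (isRoot b r) → size r ≡ 0
  size-nonroot {r} ¬root = trans (countᵇ-tabulate (λ v → finEq (rootOf b v) r) id) (∑-iverson-none _ λ u δ →
    ¬root (isRoot⁺ b (subst (λ w → lookup b w ≡ nothing) (finEq⇒≡ δ) (b-acyclic u))))

  below≡weightBelow : ∀ r → below r ≡ weightBelow size (roots b) r
  below≡weightBelow r = begin
    below r
      ≡⟨ ∑-fibres (rootOf b) (λ r′ → iverson (toℕ r′ <ᵇ toℕ r)) ⟩
    ∑[ r′ < n ] ((∑[ u < n ] iverson (finEq (rootOf b u) r′)) * iverson (toℕ r′ <ᵇ toℕ r))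
      ≡⟨ sum-cong-≗ (λ r′ → cong (_* iverson (toℕ r′ <ᵇ toℕ r))
                                 (countᵇ-tabulate (λ v → finEq (rootOf b v) r′) id)) ⟨
    ∑[ r′ < n ] (size r′ * iverson (toℕ r′ <ᵇ toℕ r))
      ≡⟨ sum-tabulate term ⟨
    sum (List.tabulate term)
      ≡⟨ cong sum (map-tabulate id term) ⟨
    sum (map term (allFin n))
      ≡⟨ sum-map-filterᵇ (isRoot b) term
           (λ r′ ¬root → cong (_* iverson (toℕ r′ <ᵇ toℕ r)) (size-nonroot ¬root)) (allFin n) ⟨
    weightBelow size (roots b) r ∎
    where
    open ≡-Reasoning
    term : Fin n → ℕ
    term r′ = size r′ * iverson (toℕ r′ <ᵇ toℕ r)

  countᵇ-admissible-nonroot : ∀ {v} → ¬ T (isRoot b v) → countᵇ (admissible v) (choices n) ≡ 1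
  countᵇ-admissible-nonroot {v} ¬root with lookup b v in eb
  ... | nothing = contradiction tt ¬root
  ... | just x  = trans (countᵇ-choices (admissibleAt (just x) v))
                        (∑-iverson-single (λ u → finEq u x) (finEq-refl x) finEq⇒≡)

  countᵇ-admissible-root : ∀ {v} → lookup b v ≡ nothing → countᵇ (admissible v) (choices n) ≡ 1 ⊔ below v
  countᵇ-admissible-root {v} eb = begin
    countᵇ (admissible v) (choices n)               ≡⟨ cong (λ m → countᵇ (admissibleAt m v) (choices n)) eb ⟩
    countᵇ (admissibleAt nothing v) (choices n)     ≡⟨ countᵇ-choices (admissibleAt nothing v) ⟩
    iverson (below v ≡ᵇ 0) + below v                ≡⟨ iverson-≡ᵇ0+≡1⊔ (below v) ⟩
    1 ⊔ below v                                     ∎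
    where open ≡-Reasoning

  product-countᵇ-admissible :
    product (List.tabulate (λ v → countᵇ (admissible v) (choices n))) ≡ bracketFactorial (bonsaiType b)
  product-countᵇ-admissible = begin
    product (List.tabulate choicesAt)
      ≡⟨ cong product (map-tabulate id choicesAt) ⟨
    product (map choicesAt (allFin n))
      ≡⟨ product-map-filterᵇ (isRoot b) choicesAt (λ _ → countᵇ-admissible-nonroot) (allFin n) ⟨
    product (map choicesAt (roots b))
      ≡⟨ cong product (map-cong-local (All.map rootChoices (roots-areRoots b))) ⟩
    product (map (λ r → 1 ⊔ weightBelow size (roots b) r) (roots b))
      ≡⟨ product-1⊔weightBelow size (roots-sorted b) (All.map 0<size (roots-areRoots b)) ⟩
    bracketFactorial (map size (roots b)) ∎
    where
    open ≡-Reasoning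
    choicesAt : Fin n → ℕ
    choicesAt v = countᵇ (admissible v) (choices n)
    rootChoices : ∀ {r} → lookup b r ≡ nothing → choicesAt r ≡ 1 ⊔ weightBelow size (roots b) r
    rootChoices {r} r-root = trans (countᵇ-admissible-root r-root) (cong (1 ⊔_) (below≡weightBelow r))

mainTheorem14 : (n : ℕ) → 1 ≤ n → (b : Parents n) → T (isBonsaiSeq b) →
    numTreesWithBonsaiSeq b ≡ bracketFactorial (bonsaiType b)
mainTheorem14 zero    ()
mainTheorem14 (suc n) _ b isBonsai = begin
  numTreesWithBonsaiSeq b
    ≡⟨ countᵇ-cong (treeWithBonsaiSeq≡everyEntry-admissible zero) (allVecs (suc n) (suc n)) ⟩
  countᵇ (everyEntry admissible) (allVecs (suc n) (suc n))
    ≡⟨ countᵇ-everyEntry-allVecs (suc n) (suc n) admissible ⟩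
  product (List.tabulate (λ v → countᵇ (admissible v) (choices (suc n))))
    ≡⟨ product-countᵇ-admissible ⟩
  bracketFactorial (bonsaiType b) ∎
  where
  open ≡-Reasoning
  open BonsaiSequence b (proj₁ (isBonsaiSeq⁻ b isBonsai)) (proj₂ (isBonsaiSeq⁻ b isBonsai))
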